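{- Fix $m\ge1$ and let $\{a_n\}_{n\ge0}$ be the $m$-gonal sequence. For $n\ge1$, consider the legal $m$-gonal decompositions of all integers $z\in[0,a_{mn+1})$; for a decomposition $z=a_{\ell_t}+\cdots+a_{\ell_1}$ with $\ell_1<\cdots<\ell_t$, its gaps are the multiset $\{\ell_2-\ell_1,\ell_3-\ell_2,\dots,\ell_t-\ell_{t-1}\}$. Let $P_n(g)$ be the fraction, among all gaps (counted with multiplicity) arising from the decompositions of all $z\in[0,a_{mn+1})$, of those of length $g$. Write $g\ge1$ as $g=m\alpha+\beta$ with $\alpha\ge0$ and $0\le\beta<m$. Then $P(g):=\lim_{n\to\infty}P_n(g)$ exists and \[ P(g)=\begin{cases}\dfrac{\beta}{m(m+1)} & \text{if } \alpha=0,\\[2mm] \dfrac{m+1-\beta}{(m+1)^{\alpha+1}} & \text{if } \alpha>0.\end{cases} \]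
   Context: Bins of an increasing sequence $\{a_n\}_{n\ge0}$: $b_0=[a_0]$, $b_k=[a_{m(k-1)+1},\dots,a_{mk}]$ for $k\ge1$. A legal $m$-gonal decomposition of $z$ is $z=a_{\ell_t}+\cdots+a_{\ell_1}$ with $\ell_1<\cdots<\ell_t$ and no two summands in the same bin. The $m$-gonal sequence: each $a_i$ is the smallest positive integer with no legal $m$-gonal decomposition using only $a_0,\dots,a_{i-1}$. Every nonnegative integer has a unique legal $m$-gonal decomposition in terms of this sequence. -}

module Defs where

open import Data.Nat using (ℕ; zero; suc; _+_; _*_; _∸_; _^_; _<_; NonZero)
open import Data.Nat.DivMod using (_/_; _%_)
open import Data.Integer using (+_)
open import Data.Rational as ℚ using (ℚ; 0ℚ)
open import Data.List using (List; []; _∷_; map; length; filter; upTo)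
open import Data.Nat.ListAction using (sum)
open import Data.List.Relation.Unary.All using (All)
open import Data.List.Relation.Unary.AllPairs using (AllPairs)
open import Data.Product using (Σ; _×_)
open import Relation.Binary.PropositionalEquality using (_≡_; _≢_)
open import Relation.Nullary using (¬_)
import Data.Nat.Properties
open Data.Nat.Properties using (_≟_)

-- Bin of an index: b_0 = {0}, b_k = {m(k-1)+1, …, mk} for k ≥ 1.
bin : (m : ℕ) → .{{NonZero m}} → ℕ → ℕ
bin m zero    = 0
bin m (suc i) = suc (i / m)

Legal : (m : ℕ) → .{{NonZero m}} → List ℕ → Set
Legal m ℓ = AllPairs _<_ ℓ × AllPairs (λ i j → bin m i ≢ bin m j) ℓ

LegalDec : (m : ℕ) → .{{NonZero m}} → (ℕ → ℕ) → List ℕ → ℕ → Set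
LegalDec m a ℓ z = Legal m ℓ × sum (map a ℓ) ≡ z

HasDecBelow : (m : ℕ) → .{{NonZero m}} → (ℕ → ℕ) → ℕ → ℕ → Set
HasDecBelow m a i z = Σ (List ℕ) λ ℓ → All (_< i) ℓ × LegalDec m a ℓ z

IsMGonal : (m : ℕ) → .{{NonZero m}} → (ℕ → ℕ) → Set
IsMGonal m a = (i : ℕ) →
  (0 < a i) × ¬ HasDecBelow m a i (a i)
  × ((y : ℕ) → 0 < y → y < a i → HasDecBelow m a i y)

gaps : List ℕ → List ℕ
gaps (x ∷ y ∷ r) = (y ∸ x) ∷ gaps (y ∷ r)
gaps _           = []

countOf : ℕ → List ℕ → ℕ
countOf g xs = length (filter (_≟ g) xs)

-- p / q as a rational, with the convention p / 0 = 0.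
frac : ℕ → ℕ → ℚ
frac p zero    = 0ℚ
frac p (suc q) = (+ p) ℚ./ suc q

-- P_n(g), given the (unique) legal decomposition dec z of every z:
-- among all gaps (with multiplicity) of the decompositions of z ∈ [0, a_{mn+1}),
-- the fraction equal to g.
Pn : (m : ℕ) → (ℕ → ℕ) → (ℕ → List ℕ) → ℕ → ℕ → ℚ
Pn m a dec n g =
  frac (sum (map (λ z → countOf g (gaps (dec z))) (upTo (a (m * n + 1)))))
       (sum (map (λ z → length (gaps (dec z))) (upTo (a (m * n + 1)))))

Plim : (m : ℕ) → .{{NonZero m}} → ℕ → ℚ
Plim m g with g / m | g % m
... | zero  | β = (+ β) ℚ./ (m * suc m)
  where instance _ : NonZero (m * suc m)
                 _ = Data.Nat.Properties.m*n≢0 m (suc m)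
... | suc α | β = (+ (suc m ∸ β)) ℚ./ (suc m ^ suc (suc α))
  where instance _ : NonZero (suc m ^ suc (suc α))
                 _ = Data.Nat.Properties.m^n≢0 (suc m) (suc (suc α))

module Submission where

-- With q = m + 1 the m-gonal sequence is explicit: a₀ = 1 and
-- a_{mk+r+1} = 2(r+1)qᵏ (r < m), since this sequence has the defining
-- property and m-gonal sequences are unique.  Then z = d + 2w
-- (d < 2) decomposes as index 0 iff d = 1, followed by the base-q digits of w
-- (digit r+1 in position k is index mk + r + 1), so the decompositions of all
-- z < a_{mn+1} correspond to the digit strings of length n, and gap counts
-- become totals over digit strings.  Shifting a string by one position adds
-- m to all indices and keeps the gaps; this gives linear recurrences for the
-- number of all gaps and of gaps g = mα + β, whose exact solution shows that
-- m q^{α+1}·Num and K·Den (Num/Den = P_n(g), K/(m q^{α+1}) = P(g)) differ by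
-- O(qⁿ), while Den ≥ n qⁿ⁻¹.  The theorem follows by a closeness criterion
-- for fractions.

open import Defs
open import Data.Nat using (ℕ; zero; suc; _+_; _*_; _∸_; _^_; _≤_; _<_; z≤n; s≤s; NonZero; pred; >-nonZero⁻¹; >-nonZero; _≤?_; _<?_)
open import Data.Nat.Properties
open import Data.Nat.DivMod
open import Data.Nat.Solver using (module +-*-Solver)
open +-*-Solver using (solve; _:+_; _:*_; _:=_; con)
open import Data.List using (List; []; _∷_; map; length; upTo; applyUpTo)
open import Data.List.Properties using (map-applyUpTo; map-cong; filter-accept; filter-reject)
open import Data.Nat.ListAction using (sum)
open import Data.List.Relation.Unary.All as All using (All; []; _∷_)
import Data.List.Relation.Unary.All.Properties as All
open import Data.List.Relation.Unary.AllPairs as AllPairs using (AllPairs; []; _∷_)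
import Data.List.Relation.Unary.AllPairs.Properties as AllPairs
open import Data.Product using (Σ; _×_; _,_; proj₁; proj₂)
open import Data.Sum using (inj₁; inj₂)
open import Data.Empty using (⊥; ⊥-elim)
open import Relation.Binary.PropositionalEquality
open import Relation.Nullary using (¬_; Dec; yes; no)
open import Relation.Binary.Definitions using (tri<; tri≈; tri>)
open import Function using (_∘_)
open import Data.Integer as ℤ using (ℤ; _⊖_; +<+)
import Data.Integer.Properties as ℤ
open import Data.Rational as ℚ using (ℚ; mkℚ)
import Data.Rational.Properties as ℚ
open import Data.Rational.Unnormalised as ℚᵘ using (mkℚᵘ; *≡*; *<*)
import Data.Rational.Unnormalised.Properties as ℚᵘ
open import Data.Nat.Coprimality using (Coprime)

∑ : (ℕ → ℕ) → ℕ → ℕ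
∑ f zero    = 0
∑ f (suc n) = f 0 + ∑ (f ∘ suc) n

sum-upTo : ∀ f n → sum (map f (upTo n)) ≡ ∑ f n
sum-upTo f n = trans (cong sum (map-applyUpTo (λ x → x) f n)) (sum-applyUpTo f n)
  where
  sum-applyUpTo : ∀ f n → sum (applyUpTo f n) ≡ ∑ f n
  sum-applyUpTo f zero    = refl
  sum-applyUpTo f (suc n) = cong (f 0 +_) (sum-applyUpTo (f ∘ suc) n)

∑-cong : ∀ {f g} n → (∀ i → i < n → f i ≡ g i) → ∑ f n ≡ ∑ g n
∑-cong zero    h = refl
∑-cong (suc n) h = cong₂ _+_ (h 0 (s≤s z≤n)) (∑-cong n (λ i i<n → h (suc i) (s≤s i<n)))

∑-mono : ∀ {f g} n → (∀ i → i < n → f i ≤ g i) → ∑ f n ≤ ∑ g n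
∑-mono zero    h = z≤n
∑-mono (suc n) h = +-mono-≤ (h 0 (s≤s z≤n)) (∑-mono n (λ i i<n → h (suc i) (s≤s i<n)))

∑-+ : ∀ f g n → ∑ (λ i → f i + g i) n ≡ ∑ f n + ∑ g n
∑-+ f g zero    = refl
∑-+ f g (suc n) = begin
  f 0 + g 0 + ∑ (λ i → f (suc i) + g (suc i)) n ≡⟨ cong (f 0 + g 0 +_) (∑-+ (f ∘ suc) (g ∘ suc) n) ⟩
  f 0 + g 0 + (∑ (f ∘ suc) n + ∑ (g ∘ suc) n)    ≡⟨ solve 4 (λ a b c d → a :+ b :+ (c :+ d) := a :+ c :+ (b :+ d)) refl (f 0) (g 0) _ _ ⟩
  f 0 + ∑ (f ∘ suc) n + (g 0 + ∑ (g ∘ suc) n)    ∎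
  where open ≡-Reasoning

∑-const : ∀ c n → ∑ (λ _ → c) n ≡ n * c
∑-const c zero    = refl
∑-const c (suc n) = cong (c +_) (∑-const c n)

∑-zero : ∀ n → ∑ (λ _ → 0) n ≡ 0
∑-zero n = trans (∑-const 0 n) (*-zeroʳ n)

∑-*ˡ : ∀ c f n → ∑ (λ i → c * f i) n ≡ c * ∑ f n
∑-*ˡ c f zero    = sym (*-zeroʳ c)
∑-*ˡ c f (suc n) = trans (cong (c * f 0 +_) (∑-*ˡ c (f ∘ suc) n)) (sym (*-distribˡ-+ c (f 0) _))

∑-split : ∀ f a b → ∑ f (a + b) ≡ ∑ f a + ∑ (λ i → f (a + i)) b
∑-split f zero    b = refl
∑-split f (suc a) b = trans (cong (f 0 +_) (∑-split (f ∘ suc) a b)) (sym (+-assoc (f 0) _ _))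

∑-snoc : ∀ f n → ∑ f (suc n) ≡ ∑ f n + f n
∑-snoc f n = begin
  ∑ f (suc n)                   ≡⟨ cong (∑ f) (+-comm 1 n) ⟩
  ∑ f (n + 1)                   ≡⟨ ∑-split f n 1 ⟩
  ∑ f n + (f (n + 0) + 0)       ≡⟨ cong (∑ f n +_) (trans (+-identityʳ _) (cong f (+-identityʳ n))) ⟩
  ∑ f n + f n                   ∎
  where open ≡-Reasoning

∑-swap : ∀ (F : ℕ → ℕ → ℕ) a b → ∑ (λ i → ∑ (F i) b) a ≡ ∑ (λ j → ∑ (λ i → F i j) a) b
∑-swap F zero    b = sym (∑-zero b)
∑-swap F (suc a) b = trans (cong (∑ (F 0) b +_) (∑-swap (F ∘ suc) a b))
                           (sym (∑-+ (F 0) (λ j → ∑ (λ i → F (suc i) j) a) b))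

∑-blocks : ∀ f N k → ∑ f (N * k) ≡ ∑ (λ j → ∑ (λ d → f (d + j * k)) k) N
∑-blocks f zero    k = refl
∑-blocks f (suc N) k = trans (∑-split f k (N * k))
  (cong₂ _+_ (∑-cong k (λ d _ → cong f (sym (+-identityʳ d))))
             (trans (∑-blocks (λ i → f (k + i)) N k)
                    (∑-cong N (λ j _ → ∑-cong k (λ d _ → cong f (reassoc d j))))))
  where
  reassoc : ∀ d j → k + (d + j * k) ≡ d + suc j * k
  reassoc d j = solve 3 (λ k d j → k :+ (d :+ j :* k) := d :+ (con 1 :+ j) :* k) refl k d j

/-as-frac : ∀ p n .{{_ : NonZero n}} → (ℤ.+ p) ℚ./ n ≡ frac p n
/-as-frac p (suc n) = refl

toℚᵘ-frac : ∀ p d → ℚ.toℚᵘ (frac p (suc d)) ℚᵘ.≃ mkℚᵘ (ℤ.+ p) d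
toℚᵘ-frac p d = ℚ.toℚᵘ-fromℚᵘ (mkℚᵘ (ℤ.+ p) d)

frac-cross : ∀ a b c d → 0 < b → 0 < d → a * d ≡ c * b → frac a b ≡ frac c d
frac-cross a (suc b) c (suc d) _ _ eq =
  ℚ.fromℚᵘ-cong {mkℚᵘ (ℤ.+ a) b} {mkℚᵘ (ℤ.+ c) d} (*≡* (trans (sym (ℤ.pos-* a (suc d))) (trans (cong ℤ.+_ eq) (ℤ.pos-* c (suc b)))))

∣⊖∣-≤ : ∀ x y X → x ≤ y + X → y ≤ x + X → ℤ.∣ x ⊖ y ∣ ≤ X
∣⊖∣-≤ x y X x≤y+X y≤x+X with x ≤? y
... | yes x≤y = subst (_≤ X) (sym (ℤ.∣⊖∣-≤ x≤y)) (m≤n+o⇒m∸n≤o y x y≤x+X)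
... | no  x≰y = subst (_≤ X) (sym (trans (ℤ.∣m⊖n∣≡∣n⊖m∣ x y) (ℤ.∣⊖∣-≤ (<⇒≤ (≰⇒> x≰y)))))
                      (m≤n+o⇒m∸n≤o x y x≤y+X)

frac-close : ∀ a b c d p r .(cop : Coprime (suc p) (suc r)) X → 0 < b → 0 < d →
  a * d ≤ c * b + X → c * b ≤ a * d + X → X * suc r < suc p * (b * d) →
  ℚ.∣ frac a b ℚ.- frac c d ∣ ℚ.< mkℚ (ℤ.+ suc p) r cop
frac-close a (suc b) c (suc d) p r cop X _ _ ad≤cb+X cb≤ad+X small =
  ℚ.toℚᵘ-cancel-< (ℚᵘ.<-respˡ-≃ (ℚᵘ.≃-sym toℚᵘ-distance) unnormalised)
  where
  x = frac a (suc b)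
  y = frac c (suc d)
  diff : ℤ
  diff = (ℤ.+ a) ℤ.* (ℤ.+ suc d) ℤ.+ (ℤ.- (ℤ.+ c)) ℤ.* (ℤ.+ suc b)
  diff≡ : diff ≡ (a * suc d) ⊖ (c * suc b)
  diff≡ = trans (cong₂ ℤ._+_ (sym (ℤ.pos-* a (suc d)))
                  (trans (sym (ℤ.neg-distribˡ-* (ℤ.+ c) (ℤ.+ suc b))) (cong ℤ.-_ (sym (ℤ.pos-* c (suc b))))))
                (ℤ.m-n≡m⊖n (a * suc d) (c * suc b))
  ∣diff∣≤X : ℤ.∣ diff ∣ ≤ X
  ∣diff∣≤X = subst (λ t → ℤ.∣ t ∣ ≤ X) (sym diff≡) (∣⊖∣-≤ _ _ X ad≤cb+X cb≤ad+X)
  unnormalised : ℚᵘ.∣ mkℚᵘ (ℤ.+ a) b ℚᵘ.- mkℚᵘ (ℤ.+ c) d ∣ ℚᵘ.< mkℚᵘ (ℤ.+ suc p) r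
  unnormalised = *<* (subst₂ ℤ._<_ (ℤ.pos-* ℤ.∣ diff ∣ (suc r)) (ℤ.pos-* (suc p) (suc b * suc d))
                       (+<+ (≤-<-trans (*-monoˡ-≤ (suc r) ∣diff∣≤X) small)))
  toℚᵘ-distance : ℚ.toℚᵘ (ℚ.∣ x ℚ.- y ∣) ℚᵘ.≃ ℚᵘ.∣ mkℚᵘ (ℤ.+ a) b ℚᵘ.- mkℚᵘ (ℤ.+ c) d ∣
  toℚᵘ-distance = ℚᵘ.≃-trans (ℚ.toℚᵘ-homo-∣-∣ (x ℚ.- y))
    (ℚᵘ.∣-∣-cong (ℚᵘ.≃-trans (ℚ.toℚᵘ-homo-+ x (ℚ.- y))
      (ℚᵘ.+-cong (toℚᵘ-frac a b) (ℚᵘ.≃-trans (ℚ.toℚᵘ-homo‿- y) (ℚᵘ.-‿cong (toℚᵘ-frac c d))))))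

-- The m-gonal sequence is determined by its defining property, so it
-- suffices to exhibit one explicit sequence having that property.

module _ (m : ℕ) .{{_ : NonZero m}} where

  decomposable-transfer : ∀ {a b} i y → (∀ j → j < i → a j ≡ b j) → HasDecBelow m a i y → HasDecBelow m b i y
  decomposable-transfer {a} {b} i y a≡b (L , below , legal , sum≡) = L , below , legal , trans (sym (agree L below)) sum≡
    where
    agree : ∀ L → All (_< i) L → sum (map a L) ≡ sum (map b L)
    agree []      []         = refl
    agree (x ∷ L) (x< ∷ L<) = cong₂ _+_ (a≡b x x<) (agree L L<)

  -- Two m-gonal sequences agreeing below i agree at i: the smaller of a i
  -- and b i would be decomposable below i for the other sequence.
  mgonal-step : ∀ {a b} → IsMGonal m a → IsMGonal m b → ∀ i → (∀ j → j < i → a j ≡ b j) → a i ≡ b i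
  mgonal-step {a} {b} isA isB i a≡b with isA i | isB i | <-cmp (a i) (b i)
  ... | _ , _ , _ | _ , _ , _ | tri≈ _ eq _ = eq
  ... | a>0 , ¬decA , _ | _ , _ , decB | tri< a<b _ _ =
    ⊥-elim (¬decA (decomposable-transfer i (a i) (λ j j<i → sym (a≡b j j<i)) (decB (a i) a>0 a<b)))
  ... | _ , _ , decA | b>0 , ¬decB , _ | tri> _ _ b<a =
    ⊥-elim (¬decB (decomposable-transfer i (b i) a≡b (decA (b i) b>0 b<a)))

  mgonal-unique : ∀ {a b} → IsMGonal m a → IsMGonal m b → ∀ i → a i ≡ b i
  mgonal-unique {a} {b} isA isB i = agree-below (suc i) i ≤-refl
    where
    agree-below : ∀ n j → j < n → a j ≡ b j
    agree-below (suc n) j j<1+n with m≤n⇒m<n∨m≡n (≤-pred j<1+n)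
    ... | inj₁ j<n  = agree-below n j j<n
    ... | inj₂ refl = mgonal-step isA isB j (agree-below j)

divmod-digit : ∀ r k d .{{_ : NonZero d}} → r < d → ((r + k * d) / d ≡ k) × ((r + k * d) % d ≡ r)
divmod-digit r k d r<d =
  trans (+-distrib-/ r (k * d) (subst (_< d) (sym remainders) r<d)) (cong₂ _+_ (m<n⇒m/n≡0 r<d) (m*n/n≡m k d)) ,
  trans ([m+kn]%n≡m%n r k d) (m<n⇒m%n≡m r<d)
  where
  remainders : r % d + (k * d) % d ≡ r
  remainders = trans (cong₂ _+_ (m<n⇒m%n≡m r<d) (m*n%n≡0 k d)) (+-identityʳ r)

digit-unique : ∀ b .{{_ : NonZero b}} d j d′ j′ → d < b → d′ < b → d + j * b ≡ d′ + j′ * b → d ≡ d′ × j ≡ j′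
digit-unique b d j d′ j′ d<b d′<b eq with divmod-digit d j b d<b | divmod-digit d′ j′ b d′<b
... | quot , rem | quot′ , rem′ =
  trans (sym rem) (trans (cong (_% b) eq) rem′) , trans (sym quot) (trans (cong (_/ b) eq) quot′)

module Gonal (m : ℕ) .{{_ : NonZero m}} where

  q : ℕ
  q = suc m

  instance
    q≢0 : NonZero q
    q≢0 = _

  index-split : ∀ i → i ≡ m * (i / m) + i % m
  index-split i = trans (m≡m%n+[m/n]*n i m) (trans (+-comm (i % m) _) (cong (_+ i % m) (*-comm (i / m) m)))

  shift-/ : ∀ i → (m + i) / m ≡ suc (i / m)
  shift-/ i = trans (m/n≡1+[m∸n]/n (m≤m+n m i)) (cong (λ t → suc (t / m)) (m+n∸m≡n m i))

  shift-% : ∀ i → (m + i) % m ≡ i % m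
  shift-% i = trans (cong (_% m) (+-comm m i)) ([m+n]%n≡m%n i m)

  bin-shift : ∀ x → bin m (m + x) ≡ suc (bin m x)
  bin-shift zero = begin
    bin m (m + 0)        ≡⟨ cong (bin m) (trans (+-identityʳ m) (sym (suc-pred m))) ⟩
    suc (pred m / m)     ≡⟨ cong suc (m<n⇒m/n≡0 (≤-reflexive (suc-pred m))) ⟩
    1                    ∎
    where open ≡-Reasoning
  bin-shift (suc i) rewrite +-suc m i = cong suc (shift-/ i)

  bin-small : ∀ x → 0 < x → x ≤ m → bin m x ≡ 1
  bin-small (suc i) _ i<m = cong suc (m<n⇒m/n≡0 i<m)

  bin-positive : ∀ x → 0 < x → 0 < bin m x
  bin-positive (suc i) _ = s≤s z≤n

  -- weight (mk + r + 1) = (r + 1)·qᵏ; the m-gonal sequence is a_i = 2·weight i for i ≥ 1.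
  weight : ℕ → ℕ
  weight zero    = 0
  weight (suc i) = suc (i % m) * q ^ (i / m)

  weight-shift : ∀ x → 0 < x → weight (m + x) ≡ q * weight x
  weight-shift (suc i) _ rewrite +-suc m i | shift-/ i | shift-% i =
    solve 3 (λ r q p → r :* (q :* p) := q :* (r :* p)) refl (suc (i % m)) q (q ^ (i / m))

  weight-small : ∀ x → 0 < x → x ≤ m → weight x ≡ x
  weight-small (suc i) _ i<m rewrite m<n⇒m%n≡m i<m | m<n⇒m/n≡0 i<m = *-identityʳ (suc i)

  value : ℕ → ℕ
  value zero    = 1
  value (suc i) = 2 * weight (suc i)

  value-positive : ∀ i → 0 < value i
  value-positive zero    = s≤s z≤n
  value-positive (suc i) = ≤-trans (≤-trans (m^n>0 q (i / m)) (m≤m+n _ _)) (m≤m+n _ _)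

  Positive : List ℕ → Set
  Positive = All (0 <_)

  shift : List ℕ → List ℕ
  shift = map (m +_)

  shift-legal : ∀ {L} → Legal m L → Legal m (shift L)
  shift-legal (increasing , bins) =
    AllPairs.map⁺ (AllPairs.map (+-monoʳ-< m) increasing) ,
    AllPairs.map⁺ (AllPairs.map (λ {x} {y} ne e → ne (suc-injective (trans (sym (bin-shift x)) (trans e (bin-shift y))))) bins)

  unshift-legal : ∀ {L} → Legal m (shift L) → Legal m L
  unshift-legal (increasing , bins) =
    AllPairs.map (λ {x} {y} → +-cancelˡ-< m x y) (AllPairs.map⁻ increasing) ,
    AllPairs.map (λ {x} {y} ne e → ne (trans (bin-shift x) (trans (cong suc e) (sym (bin-shift y))))) (AllPairs.map⁻ bins)

  shift-positive : ∀ L → Positive (shift L)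
  shift-positive L = All.map⁺ (All.tabulate (λ {x} _ → ≤-trans (>-nonZero⁻¹ m) (m≤m+n m x)))

  unshift : ∀ L → All (m <_) L → Σ (List ℕ) λ L′ → (L ≡ shift L′) × Positive L′
  unshift []      []       = [] , refl , []
  unshift (x ∷ L) (p ∷ ps) with unshift L ps
  ... | L′ , refl , pos = (x ∸ m) ∷ L′ , cong (_∷ shift L′) (sym (m+[n∸m]≡n (<⇒≤ p))) , m<n⇒0<n∸m p ∷ pos

  -- Prepend the index of a lowest base-q digit d (no index if d = 0).
  consDigit : ℕ → List ℕ → List ℕ
  consDigit zero    L = L
  consDigit (suc d) L = suc d ∷ L

  consDigit-positive : ∀ d L → Positive (consDigit d (shift L))
  consDigit-positive zero    L = shift-positive L
  consDigit-positive (suc d) L = s≤s z≤n ∷ shift-positive L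

  -- A digit index lies in bin 1, below every shifted positive index and in a different bin.
  consDigit-legal : ∀ d {L} → d < q → Positive L → Legal m L → Legal m (consDigit d (shift L))
  consDigit-legal zero    _         _   legal = shift-legal legal
  consDigit-legal (suc d) (s≤s d<m) pos legal with shift-legal legal
  ... | increasing , bins =
    All.map⁺ (All.map (λ {y} y>0 → ≤-trans (s≤s d<m) (subst (_≤ m + y) (+-comm m 1) (+-monoʳ-≤ m y>0))) pos) ∷ increasing ,
    All.map⁺ (All.map (λ {y} y>0 e → <⇒≢ (s≤s (bin-positive y y>0))
                                        (trans (sym (bin-small (suc d) (s≤s z≤n) d<m)) (trans e (bin-shift y)))) pos) ∷ bins

  record DigitSplit (L : List ℕ) : Set where
    constructor digitSplit
    field
      digit         : ℕ
      rest          : List ℕ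
      digit<q       : digit < q
      L≡            : L ≡ consDigit digit (shift rest)
      rest-legal    : Legal m rest
      rest-positive : Positive rest

  beyond-bin1 : ∀ y → 0 < y → bin m y ≢ 1 → m < y
  beyond-bin1 y y>0 ne with m <? y
  ... | yes m<y = m<y
  ... | no  m≮y = ⊥-elim (ne (bin-small y y>0 (≮⇒≥ m≮y)))

  digit-split : ∀ L → Legal m L → Positive L → DigitSplit L
  digit-split [] _ _ = digitSplit 0 [] (s≤s z≤n) refl ([] , []) []
  digit-split (x ∷ L) legal@(x< ∷ increasing , x≁ ∷ bins) (x>0 ∷ pos) with x ≤? m
  ... | yes x≤m with unshift L (All.zipWith beyond (x< , x≁))
    where
    beyond : ∀ {y} → x < y × bin m x ≢ bin m y → m < y
    beyond {y} (x<y , ne) = beyond-bin1 y (<-trans x>0 x<y) (λ e → ne (trans (bin-small x x>0 x≤m) (sym e)))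
  ... | L′ , refl , pos′ = digitSplit x L′ (s≤s x≤m) (lead x x>0) (unshift-legal (increasing , bins)) pos′
    where
    lead : ∀ x → 0 < x → x ∷ shift L′ ≡ consDigit x (shift L′)
    lead (suc x) _ = refl
  digit-split (x ∷ L) legal (x>0 ∷ pos) | no x≰m
    with unshift (x ∷ L) (≰⇒> x≰m ∷ All.map (<-trans (≰⇒> x≰m)) (proj₁ (AllPairs.uncons (proj₁ legal))))
  ... | L′ , eq , pos′ = digitSplit 0 L′ (s≤s z≤n) eq (unshift-legal (subst (Legal m) eq legal)) pos′

  -- The weight of a list is the number it represents in base q.
  weightSum : List ℕ → ℕ
  weightSum L = sum (map weight L)

  weightSum-shift : ∀ {L} → Positive L → weightSum (shift L) ≡ q * weightSum L
  weightSum-shift {[]}    _          = sym (*-zeroʳ q)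
  weightSum-shift {x ∷ L} (x>0 ∷ pos) =
    trans (cong₂ _+_ (weight-shift x x>0) (weightSum-shift pos)) (sym (*-distribˡ-+ q (weight x) (weightSum L)))

  weightSum-consDigit : ∀ d {L} → d < q → Positive L → weightSum (consDigit d (shift L)) ≡ d + q * weightSum L
  weightSum-consDigit zero    _         pos = weightSum-shift pos
  weightSum-consDigit (suc d) (s≤s d<m) pos = cong₂ _+_ (weight-small (suc d) (s≤s z≤n) d<m) (weightSum-shift pos)

  -- Legal lists of positive indices ≤ m(n+1) are the base-q representations
  -- of the numbers w < q^{n+1}.

  -- rep n w lists the indices of the base-q digits of w < q^(n+1):
  -- a digit d ≠ 0 in position k becomes the index mk + d.
  rep : ℕ → ℕ → List ℕ
  rep zero    zero    = []
  rep zero    (suc w) = suc w ∷ []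
  rep (suc n) w       = consDigit (w % q) (shift (rep n (w / q)))

  rep-step : ∀ n d j → d < q → rep (suc n) (d + j * q) ≡ consDigit d (shift (rep n j))
  rep-step n d j d<q with divmod-digit d j q d<q
  ... | quot , rem = cong₂ (λ a b → consDigit a (shift (rep n b))) rem quot

  rep-correct : ∀ n w → w < q ^ suc n → Legal m (rep n w) × Positive (rep n w) × weightSum (rep n w) ≡ w
  rep-correct zero zero    _ = ([] , []) , [] , refl
  rep-correct zero (suc w) (s≤s w<q) =
    ([] ∷ [] , [] ∷ []) , s≤s z≤n ∷ [] ,
    trans (+-identityʳ _) (weight-small (suc w) (s≤s z≤n) (subst (w <_) (*-identityʳ m) w<q))
  rep-correct (suc n) w w< with rep-correct n (w / q) (m<n*o⇒m/o<n (subst (w <_) (*-comm q (q ^ suc n)) w<))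
  ... | legal , pos , weight≡ =
    consDigit-legal (w % q) (m%n<n w q) pos legal , consDigit-positive (w % q) (rep n (w / q)) ,
    (begin
      weightSum (consDigit (w % q) (shift (rep n (w / q)))) ≡⟨ weightSum-consDigit (w % q) (m%n<n w q) pos ⟩
      w % q + q * weightSum (rep n (w / q))                 ≡⟨ cong (λ t → w % q + q * t) weight≡ ⟩
      w % q + q * (w / q)                                   ≡⟨ cong (w % q +_) (*-comm (w / q) q) ⟨
      w % q + (w / q) * q                                   ≡⟨ m≡m%n+[m/n]*n w q ⟨
      w                                                     ∎)
    where open ≡-Reasoning

  rep-positive : ∀ n w → w < q ^ suc n → Positive (rep n w)
  rep-positive n w w< = proj₁ (proj₂ (rep-correct n w w<))

  rep-bounded : ∀ n w r → r ≤ m → w < suc r * q ^ n → All (_≤ m * n + r) (rep n w)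
  rep-bounded zero zero    r _ _  = []
  rep-bounded zero (suc w) r _ w< =
    subst (suc w ≤_) (cong (_+ r) (sym (*-zeroʳ m))) (≤-pred (subst (suc w <_) (*-identityʳ (suc r)) w<)) ∷ []
  rep-bounded (suc n) w r r≤m w< = bounded (w % q) (m%n<n w q) (rep-bounded n (w / q) r r≤m quot<)
    where
    quot< : w / q < suc r * q ^ n
    quot< = m<n*o⇒m/o<n (subst (w <_) (solve 3 (λ r q p → r :* (q :* p) := r :* p :* q) refl (suc r) q (q ^ n)) w<)
    m+mn+r : m + (m * n + r) ≡ m * suc n + r
    m+mn+r = solve 3 (λ m n r → m :+ (m :* n :+ r) := m :* (con 1 :+ n) :+ r) refl m n r
    bounded : ∀ d {L} → d < q → All (_≤ m * n + r) L → All (_≤ m * suc n + r) (consDigit d (shift L))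
    bounded zero    _ ≤bound = All.map⁺ (All.map (λ {y} y≤ → subst (m + y ≤_) m+mn+r (+-monoʳ-≤ m y≤)) ≤bound)
    bounded (suc d) (s≤s d<m) ≤bound =
      ≤-trans d<m (≤-trans (≤-trans (m≤m+n m (m * n)) (≤-reflexive (sym (*-suc m n)))) (m≤m+n _ r)) ∷ bounded zero (s≤s z≤n) ≤bound

  bin1-clash : ∀ x y → 0 < x → 0 < y → x ≤ m → y ≤ m → bin m x ≢ bin m y → ⊥
  bin1-clash x y x>0 y>0 x≤m y≤m ne = ne (trans (bin-small x x>0 x≤m) (sym (bin-small y y>0 y≤m)))

  rest-bounded : ∀ d {k} L′ → All (_≤ m + k) (consDigit d (shift L′)) → All (_≤ k) L′
  rest-bounded d {k} L′ ≤bound = All.map (λ {y} → +-cancelˡ-≤ m y k) (All.map⁻ (drop d ≤bound))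
    where
    drop : ∀ d {X} → All (_≤ m + k) (consDigit d X) → All (_≤ m + k) X
    drop zero    a       = a
    drop (suc d) (_ ∷ a) = a

  rep-unique : ∀ n L → Legal m L → Positive L → All (_≤ m * suc n) L → L ≡ rep n (weightSum L)
  rep-unique zero [] _ _ _ = refl
  rep-unique zero (suc x ∷ []) _ (x>0 ∷ []) (x≤ ∷ [])
    rewrite +-identityʳ (weight (suc x)) | weight-small (suc x) x>0 (subst (suc x ≤_) (*-identityʳ m) x≤) = refl
  rep-unique zero (x ∷ y ∷ L) (_ , (ne ∷ _) ∷ _) (x>0 ∷ y>0 ∷ _) (x≤ ∷ y≤ ∷ _) =
    ⊥-elim (bin1-clash x y x>0 y>0 (subst (x ≤_) (*-identityʳ m) x≤) (subst (y ≤_) (*-identityʳ m) y≤) ne)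
  rep-unique (suc n) L legal pos ≤bound with digit-split L legal pos
  ... | digitSplit d L′ d<q refl legal′ pos′ = begin
    consDigit d (shift L′)                         ≡⟨ cong (consDigit d ∘ shift) (rep-unique n L′ legal′ pos′ ≤bound′) ⟩
    consDigit d (shift (rep n (weightSum L′)))     ≡⟨ rep-step n d (weightSum L′) d<q ⟨
    rep (suc n) (d + weightSum L′ * q)             ≡⟨ cong (λ t → rep (suc n) (d + t)) (*-comm (weightSum L′) q) ⟩
    rep (suc n) (d + q * weightSum L′)             ≡⟨ cong (rep (suc n)) (weightSum-consDigit d d<q pos′) ⟨
    rep (suc n) (weightSum (consDigit d (shift L′))) ∎
    where
    open ≡-Reasoning
    ≤bound′ : All (_≤ m * suc n) L′
    ≤bound′ = rest-bounded d L′ (subst (λ t → All (_≤ t) (consDigit d (shift L′))) (*-suc m (suc n)) ≤bound)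

  weightSum-bound : ∀ n r L → r ≤ m → Legal m L → Positive L → All (_≤ m * n + r) L → weightSum L < suc r * q ^ n
  weightSum-bound zero r [] _ _ _ _ = s≤s z≤n
  weightSum-bound zero r (x ∷ []) r≤m _ (x>0 ∷ []) (x≤ ∷ []) =
    subst (_< suc r * 1) (sym (trans (+-identityʳ _) (weight-small x x>0 (≤-trans x≤r r≤m))))
          (subst (x <_) (sym (*-identityʳ (suc r))) (s≤s x≤r))
    where
    x≤r : x ≤ r
    x≤r = subst (x ≤_) (cong (_+ r) (*-zeroʳ m)) x≤
  weightSum-bound zero r (x ∷ y ∷ L) r≤m (_ , (ne ∷ _) ∷ _) (x>0 ∷ y>0 ∷ _) (x≤ ∷ y≤ ∷ _) =
    ⊥-elim (bin1-clash x y x>0 y>0 (≤-trans (subst (x ≤_) (cong (_+ r) (*-zeroʳ m)) x≤) r≤m)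
                                    (≤-trans (subst (y ≤_) (cong (_+ r) (*-zeroʳ m)) y≤) r≤m) ne)
  weightSum-bound (suc n) r L r≤m legal pos ≤bound with digit-split L legal pos
  ... | digitSplit d L′ d<q refl legal′ pos′ = begin-strict
    weightSum (consDigit d (shift L′)) ≡⟨ weightSum-consDigit d d<q pos′ ⟩
    d + q * weightSum L′                <⟨ +-monoˡ-< (q * weightSum L′) d<q ⟩
    q + q * weightSum L′                ≡⟨ *-suc q (weightSum L′) ⟨
    q * suc (weightSum L′)              ≤⟨ *-monoʳ-≤ q (weightSum-bound n r L′ r≤m legal′ pos′ ≤bound′) ⟩
    q * (suc r * q ^ n)                 ≡⟨ solve 3 (λ q r p → q :* (r :* p) := r :* (q :* p)) refl q (suc r) (q ^ n) ⟩
    suc r * q ^ suc n                   ∎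
    where
    open ≤-Reasoning
    ≤bound′ : All (_≤ m * n + r) L′
    ≤bound′ = rest-bounded d L′ (subst (λ t → All (_≤ t) (consDigit d (shift L′)))
                                       (trans (cong (_+ r) (*-suc m n)) (+-assoc m (m * n) r)) ≤bound)

  -- The explicit sequence is m-gonal: index 0 carries the parity bit, the
  -- other indices a base-q representation.

  cons0If : ℕ → List ℕ → List ℕ
  cons0If zero    L = L
  cons0If (suc _) L = 0 ∷ L

  cons0If-all : ∀ {P : ℕ → Set} d {L} → P 0 → All P L → All P (cons0If d L)
  cons0If-all zero    _  all = all
  cons0If-all (suc d) p0 all = p0 ∷ all

  cons0If-drop : ∀ {P : ℕ → Set} d {L} → All P (cons0If d L) → All P L
  cons0If-drop zero    all       = all
  cons0If-drop (suc d) (_ ∷ all) = all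

  cons0If-legal : ∀ d {L} → d < 2 → Positive L → Legal m L → Legal m (cons0If d L)
  cons0If-legal zero       _                 _   legal = legal
  cons0If-legal (suc zero) _                 pos (increasing , bins) =
    pos ∷ increasing , All.map (λ {x} x>0 → <⇒≢ (bin-positive x x>0)) pos ∷ bins
  cons0If-legal (suc (suc _)) (s≤s (s≤s ())) _ _

  valueSum-positive : ∀ {L} → Positive L → sum (map value L) ≡ 2 * weightSum L
  valueSum-positive {[]}        []        = refl
  valueSum-positive {suc x ∷ L} (_ ∷ pos) =
    trans (cong (2 * weight (suc x) +_) (valueSum-positive pos)) (sym (*-distribˡ-+ 2 (weight (suc x)) (weightSum L)))

  valueSum-cons0If : ∀ d {L} → d < 2 → Positive L → sum (map value (cons0If d L)) ≡ d + 2 * weightSum L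
  valueSum-cons0If zero       _                 pos = valueSum-positive pos
  valueSum-cons0If (suc zero) _                 pos = cong suc (valueSum-positive pos)
  valueSum-cons0If (suc (suc _)) (s≤s (s≤s ())) _

  record ParitySplit (L : List ℕ) : Set where
    constructor paritySplit
    field
      bit           : ℕ
      bit<2         : bit < 2
      rest          : List ℕ
      L≡            : L ≡ cons0If bit rest
      rest-legal    : Legal m rest
      rest-positive : Positive rest

  parity-split : ∀ L → Legal m L → ParitySplit L
  parity-split []          _ = paritySplit 0 (s≤s z≤n) [] refl ([] , []) []
  parity-split (zero ∷ L)  (0< ∷ increasing , _ ∷ bins) = paritySplit 1 (s≤s (s≤s z≤n)) L refl (increasing , bins) 0<
  parity-split (suc x ∷ L) legal@(x< ∷ _ , _) =
    paritySplit 0 (s≤s z≤n) (suc x ∷ L) refl legal (s≤s z≤n ∷ All.map (<-trans (s≤s z≤n)) x<)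

  below-suc : ∀ i {L} → All (_< suc i) L → All (_≤ m * (i / m) + i % m) L
  below-suc i = All.map (λ {x} x<1+i → subst (x ≤_) (index-split i) (≤-pred x<1+i))

  valueSum-below : ∀ i L → All (_< i) L → Legal m L → sum (map value L) < value i
  valueSum-below zero    [] [] _ = s≤s z≤n
  valueSum-below (suc i) L below legal with parity-split L legal
  ... | paritySplit d d<2 L′ refl legal′ pos′ = begin-strict
    sum (map value (cons0If d L′)) ≡⟨ valueSum-cons0If d d<2 pos′ ⟩
    d + 2 * weightSum L′            <⟨ +-monoˡ-< (2 * weightSum L′) d<2 ⟩
    2 + 2 * weightSum L′            ≡⟨ *-suc 2 (weightSum L′) ⟨
    2 * suc (weightSum L′)          ≤⟨ *-monoʳ-≤ 2 (weightSum-bound (i / m) (i % m) L′ (<⇒≤ (m%n<n i m)) legal′ pos′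
                                                                   (cons0If-drop d (below-suc i below))) ⟩
    value (suc i)                   ∎
    where open ≤-Reasoning

  -- Every y < value i has a legal decomposition below i: the bit y % 2 and
  -- the base-q representation of y / 2.
  value-decomposable : ∀ i y → y < value i → HasDecBelow m value i y
  value-decomposable zero    zero    _        = [] , [] , ([] , []) , refl
  value-decomposable zero    (suc y) (s≤s ())
  value-decomposable (suc i) y       y<       =
    cons0If b (rep k w) , cons0If-all b (s≤s z≤n) rep-below , cons0If-legal b b<2 pos legal , sum≡
    where
    k = i / m
    r = i % m
    w = y / 2
    b = y % 2
    b<2 : b < 2
    b<2 = m%n<n y 2
    w< : w < suc r * q ^ k
    w< = m<n*o⇒m/o<n (subst (y <_) (*-comm 2 (suc r * q ^ k)) y<)
    correct : Legal m (rep k w) × Positive (rep k w) × weightSum (rep k w) ≡ w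
    correct = rep-correct k w (<-≤-trans w< (*-monoˡ-≤ (q ^ k) (s≤s (<⇒≤ (m%n<n i m)))))
    legal : Legal m (rep k w)
    legal = proj₁ correct
    pos : Positive (rep k w)
    pos = proj₁ (proj₂ correct)
    rep-below : All (_< suc i) (rep k w)
    rep-below = All.map (λ {x} x≤ → s≤s (subst (x ≤_) (sym (index-split i)) x≤)) (rep-bounded k w r (<⇒≤ (m%n<n i m)) w<)
    sum≡ : sum (map value (cons0If b (rep k w))) ≡ y
    sum≡ = begin
      sum (map value (cons0If b (rep k w))) ≡⟨ valueSum-cons0If b b<2 pos ⟩
      b + 2 * weightSum (rep k w)           ≡⟨ cong (λ t → b + 2 * t) (proj₂ (proj₂ correct)) ⟩
      b + 2 * w                             ≡⟨ cong (b +_) (*-comm 2 w) ⟩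
      b + w * 2                             ≡⟨ m≡m%n+[m/n]*n y 2 ⟨
      y                                     ∎
      where open ≡-Reasoning

  value-isMGonal : IsMGonal m value
  value-isMGonal i =
    value-positive i ,
    (λ (L , below , legal , sum≡) → <-irrefl sum≡ (valueSum-below i L below legal)) ,
    (λ y _ y< → value-decomposable i y y<)

  summand≤sum : ∀ (f : ℕ → ℕ) L → All (λ x → f x ≤ sum (map f L)) L
  summand≤sum f []      = []
  summand≤sum f (x ∷ L) = m≤m+n (f x) _ ∷ All.map (λ {y} fy≤ → ≤-trans fy≤ (m≤n+m _ (f x))) (summand≤sum f L)

  value-large : ∀ n x → m * suc n < x → 2 * q ^ suc n ≤ value x
  value-large n (suc i) (s≤s mn<i) = *-monoʳ-≤ 2 (≤-trans (^-monoʳ-≤ q n<i/m) (m≤m+n _ _))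
    where
    n<i/m : suc n ≤ i / m
    n<i/m = subst (_≤ i / m) (trans (cong (_/ m) (*-comm m (suc n))) (m*n/n≡m (suc n) m)) (/-monoˡ-≤ m mn<i)

  below-top : ∀ n d j → d < 2 → j < q ^ suc n → d + j * 2 < 2 * q ^ suc n
  below-top n d j d<2 j< = begin-strict
    d + j * 2     <⟨ +-monoˡ-< (j * 2) d<2 ⟩
    2 + j * 2     ≡⟨ *-comm (suc j) 2 ⟩
    2 * suc j     ≤⟨ *-monoʳ-≤ 2 j< ⟩
    2 * q ^ suc n ∎
    where open ≤-Reasoning

  module Decompositions (a : ℕ → ℕ) (isM : IsMGonal m a)
                        (dec : ℕ → List ℕ) (decOK : (z : ℕ) → LegalDec m a (dec z) z) where

    a≡value : ∀ i → a i ≡ value i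
    a≡value = mgonal-unique m isM value-isMGonal

    a-top : ∀ n → a (m * suc n + 1) ≡ q ^ suc n * 2
    a-top n = begin
      a (m * suc n + 1)                                      ≡⟨ a≡value _ ⟩
      value (m * suc n + 1)                                  ≡⟨ cong value (+-comm (m * suc n) 1) ⟩
      2 * (suc ((m * suc n) % m) * q ^ ((m * suc n) / m))    ≡⟨ cong₂ (λ u v → 2 * (suc u * q ^ v)) mod≡ div≡ ⟩
      2 * (1 * q ^ suc n)                                    ≡⟨ solve 1 (λ p → con 2 :* (con 1 :* p) := p :* con 2) refl (q ^ suc n) ⟩
      q ^ suc n * 2                                          ∎
      where
      open ≡-Reasoning
      mod≡ : (m * suc n) % m ≡ 0
      mod≡ = trans (cong (_% m) (*-comm m (suc n))) (m*n%n≡0 (suc n) m)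
      div≡ : (m * suc n) / m ≡ suc n
      div≡ = trans (cong (_/ m) (*-comm m (suc n))) (m*n/n≡m (suc n) m)

    dec-valueSum : ∀ z → sum (map value (dec z)) ≡ z
    dec-valueSum z = trans (cong sum (sym (map-cong a≡value (dec z)))) (proj₂ (decOK z))

    dec-bounded : ∀ n z → z < 2 * q ^ suc n → All (_≤ m * suc n) (dec z)
    dec-bounded n z z< = All.map (λ {x} vx≤ → small x (subst (value x ≤_) (dec-valueSum z) vx≤)) (summand≤sum value (dec z))
      where
      small : ∀ x → value x ≤ z → x ≤ m * suc n
      small x vx≤z with m * suc n <? x
      ... | yes big = ⊥-elim (<-irrefl refl (<-≤-trans z< (≤-trans (value-large n x big) vx≤z)))
      ... | no ¬big = ≮⇒≥ ¬big

    dec-rep : ∀ n d j → d < 2 → j < q ^ suc n → dec (d + j * 2) ≡ cons0If d (rep n j)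
    dec-rep n d j d<2 j< with parity-split (dec (d + j * 2)) (proj₁ (decOK (d + j * 2)))
    ... | paritySplit b b<2 L′ dec≡ legal′ pos′ = begin
      dec z                             ≡⟨ dec≡ ⟩
      cons0If b L′                      ≡⟨ cong₂ cons0If (proj₁ bit-and-weight) (rep-unique n L′ legal′ pos′ bounded) ⟩
      cons0If d (rep n (weightSum L′))  ≡⟨ cong (cons0If d ∘ rep n) (proj₂ bit-and-weight) ⟩
      cons0If d (rep n j)               ∎
      where
      open ≡-Reasoning
      z = d + j * 2
      split≡ : b + weightSum L′ * 2 ≡ d + j * 2
      split≡ = begin
        b + weightSum L′ * 2                 ≡⟨ cong (b +_) (*-comm (weightSum L′) 2) ⟩
        b + 2 * weightSum L′                 ≡⟨ valueSum-cons0If b b<2 pos′ ⟨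
        sum (map value (cons0If b L′))       ≡⟨ cong (sum ∘ map value) dec≡ ⟨
        sum (map value (dec z))              ≡⟨ dec-valueSum z ⟩
        z                                    ∎
      bit-and-weight : b ≡ d × weightSum L′ ≡ j
      bit-and-weight = digit-unique 2 b (weightSum L′) d j b<2 d<2 split≡
      bounded : All (_≤ m * suc n) L′
      bounded = cons0If-drop b (subst (All (_≤ m * suc n)) dec≡ (dec-bounded n z (below-top n d j d<2 j<)))

  indicator : ∀ {A : Set} → Dec A → ℕ
  indicator (yes _) = 1
  indicator (no _)  = 0

  indicator-iff : ∀ {A B : Set} (a : Dec A) (b : Dec B) → (A → B) → (B → A) → indicator a ≡ indicator b
  indicator-iff (yes _) (yes _) _ _ = refl
  indicator-iff (yes a) (no ¬b) f _ = ⊥-elim (¬b (f a))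
  indicator-iff (no ¬a) (yes b) _ g = ⊥-elim (¬a (g b))
  indicator-iff (no _)  (no _)  _ _ = refl

  indicator-no : ∀ {A : Set} (a : Dec A) → ¬ A → indicator a ≡ 0
  indicator-no (yes a) ¬a = ⊥-elim (¬a a)
  indicator-no (no _)  _  = refl

  indicator-yes : ∀ {A : Set} (a : Dec A) → A → indicator a ≡ 1
  indicator-yes (yes _) _ = refl
  indicator-yes (no ¬a) a = ⊥-elim (¬a a)

  indicator≤1 : ∀ {A : Set} (a : Dec A) → indicator a ≤ 1
  indicator≤1 (yes _) = s≤s z≤n
  indicator≤1 (no _)  = z≤n

  countOf-∷ : ∀ g x xs → countOf g (x ∷ xs) ≡ indicator (x ≟ g) + countOf g xs
  countOf-∷ g x xs with x ≟ g
  ... | yes x≡g = cong length (filter-accept (_≟ g) x≡g)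
  ... | no  x≢g = cong length (filter-reject (_≟ g) x≢g)

  gapCount : ℕ → List ℕ → ℕ
  gapCount g L = countOf g (gaps L)

  gapTotal : List ℕ → ℕ
  gapTotal L = length (gaps L)

  headIs : ℕ → List ℕ → ℕ
  headIs h []      = 0
  headIs h (x ∷ _) = indicator (x ≟ h)

  nonEmpty : List ℕ → ℕ
  nonEmpty []      = 0
  nonEmpty (_ ∷ _) = 1

  headGap : ℕ → ℕ → List ℕ → ℕ
  headGap g d []      = 0
  headGap g d (y ∷ _) = indicator ((y ∸ d) ≟ g)

  gapCount-∷ : ∀ g d L → gapCount g (d ∷ L) ≡ headGap g d L + gapCount g L
  gapCount-∷ g d []      = refl
  gapCount-∷ g d (y ∷ L) = countOf-∷ g (y ∸ d) (gaps (y ∷ L))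

  gapTotal-∷ : ∀ d L → gapTotal (d ∷ L) ≡ nonEmpty L + gapTotal L
  gapTotal-∷ d []      = refl
  gapTotal-∷ d (y ∷ L) = refl

  gaps-shift : ∀ L → gaps (shift L) ≡ gaps L
  gaps-shift []          = refl
  gaps-shift (x ∷ [])    = refl
  gaps-shift (x ∷ y ∷ L) = cong₂ _∷_ ([m+n]∸[m+o]≡n∸o m y x) (gaps-shift (y ∷ L))

  gapCount-shift : ∀ g L → gapCount g (shift L) ≡ gapCount g L
  gapCount-shift g L = cong (countOf g) (gaps-shift L)

  gapTotal-shift : ∀ L → gapTotal (shift L) ≡ gapTotal L
  gapTotal-shift L = cong length (gaps-shift L)

  nonEmpty-shift : ∀ L → nonEmpty (shift L) ≡ nonEmpty L
  nonEmpty-shift []      = refl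
  nonEmpty-shift (_ ∷ _) = refl

  nonEmpty≤1 : ∀ L → nonEmpty L ≤ 1
  nonEmpty≤1 []      = z≤n
  nonEmpty≤1 (_ ∷ _) = s≤s z≤n

  headIs≤1 : ∀ h L → headIs h L ≤ 1
  headIs≤1 h []      = z≤n
  headIs≤1 h (y ∷ L) = indicator≤1 (y ≟ h)

  headIs-zero : ∀ L → Positive L → headIs 0 L ≡ 0
  headIs-zero []      _         = refl
  headIs-zero (y ∷ L) (y>0 ∷ _) = indicator-no (y ≟ 0) (λ y≡0 → <⇒≢ y>0 (sym y≡0))

  headIs-shift-small : ∀ h L → h ≤ m → Positive L → headIs h (shift L) ≡ 0
  headIs-shift-small h []      _   _         = refl
  headIs-shift-small h (y ∷ L) h≤m (y>0 ∷ _) =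
    indicator-no ((m + y) ≟ h) (λ e → <-irrefl (sym e) (≤-trans (s≤s h≤m) (subst (_≤ m + y) (+-comm m 1) (+-monoʳ-≤ m y>0))))

  headIs-shift : ∀ h L → headIs (m + h) (shift L) ≡ headIs h L
  headIs-shift h []      = refl
  headIs-shift h (y ∷ L) = indicator-iff ((m + y) ≟ (m + h)) (y ≟ h) (+-cancelˡ-≡ m y h) (cong (m +_))

  headGap-shift : ∀ g d L → d ≤ m → Positive L → headGap g d (shift L) ≡ headIs (g + d ∸ m) L
  headGap-shift g d []      _   _         = refl
  headGap-shift g d (y ∷ L) d≤m (y>0 ∷ _) = indicator-iff ((m + y ∸ d) ≟ g) (y ≟ (g + d ∸ m)) gap⇒head head⇒gap
    where
    gap⇒head : m + y ∸ d ≡ g → y ≡ g + d ∸ m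
    gap⇒head gap≡ = sym (begin
      g + d ∸ m             ≡⟨ cong (λ t → t + d ∸ m) (trans (sym gap≡) (+-∸-comm y d≤m)) ⟩
      (m ∸ d) + y + d ∸ m   ≡⟨ cong (_∸ m) (solve 3 (λ t y d → t :+ y :+ d := t :+ d :+ y) refl (m ∸ d) y d) ⟩
      (m ∸ d) + d + y ∸ m   ≡⟨ cong (λ t → t + y ∸ m) (m∸n+n≡m d≤m) ⟩
      m + y ∸ m             ≡⟨ m+n∸m≡n m y ⟩
      y                     ∎)
      where open ≡-Reasoning
    head⇒gap : y ≡ g + d ∸ m → m + y ∸ d ≡ g
    head⇒gap y≡ = begin
      m + y ∸ d             ≡⟨ cong (λ t → m + t ∸ d) y≡ ⟩
      m + (g + d ∸ m) ∸ d   ≡⟨ cong (_∸ d) (m+[n∸m]≡n {m} (<⇒≤ (m∸n≢0⇒n<m (λ e → <⇒≢ y>0 (sym (trans y≡ e)))))) ⟩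
      g + d ∸ d             ≡⟨ m+n∸n≡m g d ⟩
      g                     ∎
      where open ≡-Reasoning

  total : ℕ → (List ℕ → ℕ) → ℕ
  total n F = ∑ (λ w → F (rep n w)) (q ^ suc n)

  -- A representation of length n + 2 is a shifted representation of length
  -- n + 1, preceded by no digit index or by one of the indices 1, …, m.
  total-suc : ∀ n F → total (suc n) F ≡ ∑ (λ j → F (shift (rep n j)) + ∑ (λ d → F (suc d ∷ shift (rep n j))) m) (q ^ suc n)
  total-suc n F = begin
    ∑ (λ w → F (rep (suc n) w)) (q * q ^ suc n)                   ≡⟨ cong (∑ (λ w → F (rep (suc n) w))) (*-comm q (q ^ suc n)) ⟩
    ∑ (λ w → F (rep (suc n) w)) (q ^ suc n * q)                   ≡⟨ ∑-blocks (λ w → F (rep (suc n) w)) (q ^ suc n) q ⟩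
    ∑ (λ j → ∑ (λ d → F (rep (suc n) (d + j * q))) q) (q ^ suc n) ≡⟨ ∑-cong (q ^ suc n) (λ j _ → cong₂ _+_
                                                                       (cong F (rep-step n 0 j (s≤s z≤n)))
                                                                       (∑-cong m (λ d d<m → cong F (rep-step n (suc d) j (s≤s d<m))))) ⟩
    ∑ (λ j → F (shift (rep n j)) + ∑ (λ d → F (suc d ∷ shift (rep n j))) m) (q ^ suc n) ∎
    where open ≡-Reasoning

  total-zero : ∀ F → total 0 F ≡ F [] + ∑ (λ d → F (suc d ∷ [])) m
  total-zero F = cong (∑ (λ w → F (rep 0 w))) (*-identityʳ q)

  total-linear : ∀ n F A B → (∀ L → Positive L → F (shift L) ≡ A L)
    → (∀ d L → Positive L → F (suc d ∷ shift L) ≡ B L)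
    → total (suc n) F ≡ total n A + m * total n B
  total-linear n F A B shiftA digitB = begin
    total (suc n) F                                        ≡⟨ total-suc n F ⟩
    ∑ (λ j → F (shift (R j)) + ∑ (λ d → F (suc d ∷ shift (R j))) m) Q
                                                           ≡⟨ ∑-cong Q (λ j j< → cong₂ _+_ (shiftA (R j) (rep-positive n j j<))
                                                                (trans (∑-cong m (λ d _ → digitB d (R j) (rep-positive n j j<))) (∑-const (B (R j)) m))) ⟩
    ∑ (λ j → A (R j) + m * B (R j)) Q                      ≡⟨ ∑-+ (A ∘ R) (λ j → m * B (R j)) Q ⟩
    total n A + ∑ (λ j → m * B (R j)) Q                    ≡⟨ cong (total n A +_) (∑-*ˡ m (B ∘ R) Q) ⟩
    total n A + m * total n B                              ∎
    where
    open ≡-Reasoning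
    Q = q ^ suc n
    R = rep n

  total-bounded : ∀ n F → (∀ L → F L ≤ 1) → total n F ≤ q ^ suc n
  total-bounded n F F≤1 = ≤-trans (∑-mono (q ^ suc n) (λ j _ → F≤1 (rep n j)))
                                  (≤-reflexive (trans (∑-const 1 (q ^ suc n)) (*-identityʳ (q ^ suc n))))

  -- Only the representation of 0 is empty.
  total-nonEmpty : ∀ n → total n nonEmpty + 1 ≡ q ^ suc n
  total-nonEmpty zero = begin
    total 0 nonEmpty + 1          ≡⟨ cong (_+ 1) (trans (total-zero nonEmpty) (trans (∑-const 1 m) (*-identityʳ m))) ⟩
    m + 1                         ≡⟨ solve 1 (λ m → m :+ con 1 := (con 1 :+ m) :* con 1) refl m ⟩
    q ^ 1                         ∎
    where open ≡-Reasoning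
  total-nonEmpty (suc n) = begin
    total (suc n) nonEmpty + 1                   ≡⟨ cong (_+ 1) (total-linear n nonEmpty nonEmpty (λ _ → 1) (λ L _ → nonEmpty-shift L) (λ _ _ _ → refl)) ⟩
    total n nonEmpty + m * total n (λ _ → 1) + 1 ≡⟨ cong (λ t → total n nonEmpty + m * t + 1) (trans (∑-const 1 Q) (*-identityʳ Q)) ⟩
    total n nonEmpty + m * Q + 1                 ≡⟨ solve 3 (λ x m Q → x :+ m :* Q :+ con 1 := (x :+ con 1) :+ m :* Q) refl (total n nonEmpty) m Q ⟩
    (total n nonEmpty + 1) + m * Q               ≡⟨ cong (_+ m * Q) (total-nonEmpty n) ⟩
    Q + m * Q                                    ∎
    where
    open ≡-Reasoning
    Q = q ^ suc n

  -- Prepending a digit adds one gap to every nonempty list.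
  total-gapTotal-suc : ∀ n → total (suc n) gapTotal ≡ q * total n gapTotal + m * total n nonEmpty
  total-gapTotal-suc n = begin
    total (suc n) gapTotal                      ≡⟨ total-linear n gapTotal gapTotal (λ L → nonEmpty L + gapTotal L) (λ L _ → gapTotal-shift L)
                                                     (λ d L _ → trans (gapTotal-∷ (suc d) (shift L)) (cong₂ _+_ (nonEmpty-shift L) (gapTotal-shift L))) ⟩
    GT + m * total n (λ L → nonEmpty L + gapTotal L) ≡⟨ cong (λ t → GT + m * t) (∑-+ (nonEmpty ∘ rep n) (gapTotal ∘ rep n) (q ^ suc n)) ⟩
    GT + m * (NE + GT)                          ≡⟨ solve 3 (λ m G N → G :+ m :* (N :+ G) := (con 1 :+ m) :* G :+ m :* N) refl m GT NE ⟩
    q * GT + m * NE                             ∎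
    where
    open ≡-Reasoning
    GT = total n gapTotal
    NE = total n nonEmpty

  total-gapTotal : ∀ n → total n gapTotal + q ^ suc n ≡ suc n * m * q ^ n + 1
  total-gapTotal zero = begin
    total 0 gapTotal + q * 1  ≡⟨ cong (_+ q * 1) (trans (total-zero gapTotal) (∑-zero m)) ⟩
    q * 1                     ≡⟨ solve 1 (λ m → (con 1 :+ m) :* con 1 := con 1 :* m :* con 1 :+ con 1) refl m ⟩
    1 * m * 1 + 1             ∎
    where open ≡-Reasoning
  total-gapTotal (suc n) = +-cancelʳ-≡ m _ _ (begin
    total (suc n) gapTotal + q * Q + m   ≡⟨ cong (λ t → t + q * Q + m) (total-gapTotal-suc n) ⟩
    q * GT + m * NE + q * Q + m          ≡⟨ solve 4 (λ m Q G N → (con 1 :+ m) :* G :+ m :* N :+ (con 1 :+ m) :* Q :+ m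
                                                   := (con 1 :+ m) :* (G :+ Q) :+ m :* (N :+ con 1)) refl m Q GT NE ⟩
    q * (GT + Q) + m * (NE + 1)          ≡⟨ cong₂ (λ s t → q * s + m * t) (total-gapTotal n) (total-nonEmpty n) ⟩
    q * (suc n * m * q ^ n + 1) + m * Q  ≡⟨ solve 3 (λ m n p → (con 1 :+ m) :* ((con 1 :+ n) :* m :* p :+ con 1) :+ m :* ((con 1 :+ m) :* p)
                                                   := (con 1 :+ (con 1 :+ n)) :* m :* ((con 1 :+ m) :* p) :+ con 1 :+ m) refl m n (q ^ n) ⟩
    suc (suc n) * m * Q + 1 + m          ∎)
    where
    open ≡-Reasoning
    Q = q ^ suc n
    GT = total n gapTotal
    NE = total n nonEmpty

  headTotal : ℕ → ℕ → ℕ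
  headTotal n h = total n (headIs h)

  digitHits : ℕ → ℕ → ℕ
  digitHits k h = ∑ (λ d → indicator (suc d ≟ h)) k

  digitHits-big : ∀ k h → k < h → digitHits k h ≡ 0
  digitHits-big k h k<h = trans (∑-cong k (λ d d<k → indicator-no (suc d ≟ h) (λ e → <-irrefl e (≤-<-trans d<k k<h)))) (∑-zero k)

  digitHits-small : ∀ k d → d < k → digitHits k (suc d) ≡ 1
  digitHits-small (suc k) d d<1+k with m≤n⇒m<n∨m≡n (≤-pred d<1+k)
  ... | inj₁ d<k  = trans (∑-snoc _ k) (cong₂ _+_ (digitHits-small k d d<k)
                                                  (indicator-no (suc k ≟ suc d) (λ e → <-irrefl (sym (suc-injective e)) d<k)))
  ... | inj₂ refl = trans (∑-snoc _ k) (cong₂ _+_ (digitHits-big k (suc k) ≤-refl) (indicator-yes (suc k ≟ suc k) refl))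

  headTotal-suc : ∀ n h → headTotal (suc n) h ≡ ∑ (λ j → headIs h (shift (rep n j))) (q ^ suc n) + q ^ suc n * digitHits m h
  headTotal-suc n h = begin
    headTotal (suc n) h                                   ≡⟨ total-suc n (headIs h) ⟩
    ∑ (λ j → headIs h (shift (rep n j)) + digitHits m h) Q ≡⟨ ∑-+ (λ j → headIs h (shift (rep n j))) (λ _ → digitHits m h) Q ⟩
    ∑ (λ j → headIs h (shift (rep n j))) Q + ∑ (λ _ → digitHits m h) Q ≡⟨ cong (∑ (λ j → headIs h (shift (rep n j))) Q +_) (∑-const (digitHits m h) Q) ⟩
    ∑ (λ j → headIs h (shift (rep n j))) Q + Q * digitHits m h ∎
    where
    open ≡-Reasoning
    Q = q ^ suc n

  headTotal-small : ∀ n h → 0 < h → h ≤ m → headTotal n h ≡ q ^ n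
  headTotal-small zero    (suc d) _ h≤m = trans (total-zero (headIs (suc d))) (digitHits-small m d h≤m)
  headTotal-small (suc n) (suc d) _ h≤m = begin
    headTotal (suc n) (suc d)                                   ≡⟨ headTotal-suc n (suc d) ⟩
    ∑ (λ j → headIs (suc d) (shift (rep n j))) Q + Q * digitHits m (suc d)
                                                                ≡⟨ cong₂ _+_ (trans (∑-cong Q (λ j j< → headIs-shift-small (suc d) (rep n j) h≤m (rep-positive n j j<))) (∑-zero Q))
                                                                             (cong (Q *_) (digitHits-small m d h≤m)) ⟩
    Q * 1                                                       ≡⟨ *-identityʳ Q ⟩
    Q                                                           ∎
    where
    open ≡-Reasoning
    Q = q ^ suc n

  headTotal-shift : ∀ n h → 0 < h → headTotal (suc n) (m + h) ≡ headTotal n h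
  headTotal-shift n h h>0 = begin
    headTotal (suc n) (m + h)                                          ≡⟨ headTotal-suc n (m + h) ⟩
    ∑ (λ j → headIs (m + h) (shift (rep n j))) Q + Q * digitHits m (m + h)
                                                                       ≡⟨ cong₂ _+_ (∑-cong Q (λ j _ → headIs-shift h (rep n j)))
                                                                                    (cong (Q *_) (digitHits-big m (m + h) m<m+h)) ⟩
    headTotal n h + Q * 0                                              ≡⟨ cong (headTotal n h +_) (*-zeroʳ Q) ⟩
    headTotal n h + 0                                                  ≡⟨ +-identityʳ _ ⟩
    headTotal n h                                                      ∎
    where
    open ≡-Reasoning
    Q = q ^ suc n
    m<m+h : m < m + h
    m<m+h = subst (_≤ m + h) (+-comm m 1) (+-monoʳ-≤ m h>0)

  headTotal-zero : ∀ n → headTotal n 0 ≡ 0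
  headTotal-zero n = trans (∑-cong (q ^ suc n) (λ j j< → headIs-zero (rep n j) (rep-positive n j j<))) (∑-zero (q ^ suc n))

  headTotal-formula : ∀ p n d → d < m → p ≤ n → headTotal n (m * p + suc d) ≡ q ^ (n ∸ p)
  headTotal-formula zero    n       d d<m _         = trans (cong (λ t → headTotal n (t + suc d)) (*-zeroʳ m)) (headTotal-small n (suc d) (s≤s z≤n) d<m)
  headTotal-formula (suc p) (suc n) d d<m (s≤s p≤n) = begin
    headTotal (suc n) (m * suc p + suc d)    ≡⟨ cong (headTotal (suc n)) (trans (cong (_+ suc d) (*-suc m p)) (+-assoc m (m * p) (suc d))) ⟩
    headTotal (suc n) (m + (m * p + suc d))  ≡⟨ headTotal-shift n (m * p + suc d) (≤-trans (s≤s z≤n) (m≤n+m (suc d) (m * p))) ⟩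
    headTotal n (m * p + suc d)              ≡⟨ headTotal-formula p n d d<m p≤n ⟩
    q ^ (n ∸ p)                              ∎
    where open ≡-Reasoning

  gapCount-digit : ∀ g d L → d < m → Positive L → gapCount g (suc d ∷ shift L) ≡ headIs (g + suc d ∸ m) L + gapCount g L
  gapCount-digit g d L d<m pos =
    trans (gapCount-∷ g (suc d) (shift L)) (cong₂ _+_ (headGap-shift g (suc d) L d<m pos) (gapCount-shift g L))

  -- Gaps of length g created by the lowest digit, over all representations.
  newGaps : ℕ → ℕ → ℕ
  newGaps g n = ∑ (λ d → headTotal n (g + suc d ∸ m)) m

  gapCount-suc : ∀ g n → total (suc n) (gapCount g) ≡ q * total n (gapCount g) + newGaps g n
  gapCount-suc g n = begin
    total (suc n) (gapCount g)                          ≡⟨ total-suc n (gapCount g) ⟩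
    ∑ (λ j → gapCount g (shift (R j)) + ∑ (λ d → gapCount g (suc d ∷ shift (R j))) m) Q
                                                        ≡⟨ ∑-cong Q (λ j j< → per-representation j (rep-positive n j j<)) ⟩
    ∑ (λ j → q * c j + H j) Q                           ≡⟨ ∑-+ (λ j → q * c j) H Q ⟩
    ∑ (λ j → q * c j) Q + ∑ H Q                         ≡⟨ cong₂ _+_ (∑-*ˡ q c Q) (∑-swap (λ j d → headIs (g + suc d ∸ m) (R j)) Q m) ⟩
    q * total n (gapCount g) + newGaps g n              ∎
    where
    open ≡-Reasoning
    Q = q ^ suc n
    R = rep n
    c : ℕ → ℕ
    c j = gapCount g (R j)
    H : ℕ → ℕ
    H j = ∑ (λ d → headIs (g + suc d ∸ m) (R j)) m
    per-representation : ∀ j → Positive (R j) →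
      gapCount g (shift (R j)) + ∑ (λ d → gapCount g (suc d ∷ shift (R j))) m ≡ q * c j + H j
    per-representation j pos = begin
      gapCount g (shift (R j)) + ∑ (λ d → gapCount g (suc d ∷ shift (R j))) m
                                          ≡⟨ cong₂ _+_ (gapCount-shift g (R j)) (∑-cong m (λ d d<m → gapCount-digit g d (R j) d<m pos)) ⟩
      c j + ∑ (λ d → headIs (g + suc d ∸ m) (R j) + c j) m
                                          ≡⟨ cong (c j +_) (trans (∑-+ (λ d → headIs (g + suc d ∸ m) (R j)) (λ _ → c j) m)
                                                                  (cong (H j +_) (∑-const (c j) m))) ⟩
      c j + (H j + m * c j)               ≡⟨ solve 3 (λ c H m → c :+ (H :+ m :* c) := (con 1 :+ m) :* c :+ H) refl (c j) (H j) m ⟩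
      q * c j + H j                       ∎

  -- For g = mα + β (β < m) the new gaps number K α β · q^{n-α}, where
  -- K 0 β = β and K (α+1) β = (m - β)q + β.
  K : ℕ → ℕ → ℕ
  K zero    β = β
  K (suc α) β = (m ∸ β) * q + β

  -- The digits d = m - β + i (i < β) create a gap g after the index mα + i + 1.
  newGaps-split : ∀ α β n → β < m → α ≤ n →
    newGaps (m * α + β) n ≡ ∑ (λ d → headTotal n (m * α + β + suc d ∸ m)) (m ∸ β) + β * q ^ (n ∸ α)
  newGaps-split α β n β<m α≤n = begin
    ∑ f m                                     ≡⟨ cong (∑ f) (m∸n+n≡m (<⇒≤ β<m)) ⟨
    ∑ f ((m ∸ β) + β)                         ≡⟨ ∑-split f (m ∸ β) β ⟩
    ∑ f (m ∸ β) + ∑ (λ i → f (m ∸ β + i)) β   ≡⟨ cong (∑ f (m ∸ β) +_) (trans (∑-cong β high) (∑-const (q ^ (n ∸ α)) β)) ⟩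
    ∑ f (m ∸ β) + β * q ^ (n ∸ α)             ∎
    where
    open ≡-Reasoning
    f : ℕ → ℕ
    f d = headTotal n (m * α + β + suc d ∸ m)
    index≡ : ∀ i → m * α + β + suc (m ∸ β + i) ∸ m ≡ m * α + suc i
    index≡ i = begin
      m * α + β + suc (m ∸ β + i) ∸ m         ≡⟨ cong (_∸ m) (solve 4 (λ y b t i → y :+ b :+ (con 1 :+ (t :+ i)) := (b :+ t) :+ (y :+ (con 1 :+ i)))
                                                                     refl (m * α) β (m ∸ β) i) ⟩
      (β + (m ∸ β)) + (m * α + suc i) ∸ m     ≡⟨ cong (λ t → t + (m * α + suc i) ∸ m) (m+[n∸m]≡n (<⇒≤ β<m)) ⟩
      m + (m * α + suc i) ∸ m                 ≡⟨ m+n∸m≡n m _ ⟩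
      m * α + suc i                           ∎
    high : ∀ i → i < β → f (m ∸ β + i) ≡ q ^ (n ∸ α)
    high i i<β = trans (cong (headTotal n) (index≡ i)) (headTotal-formula α n i (<-trans i<β β<m) α≤n)

  newGaps-value : ∀ α β n → β < m → α ≤ n → newGaps (m * α + β) n ≡ K α β * q ^ (n ∸ α)
  newGaps-value zero β n β<m α≤n = begin
    newGaps (m * 0 + β) n                                              ≡⟨ newGaps-split zero β n β<m α≤n ⟩
    ∑ (λ d → headTotal n (m * 0 + β + suc d ∸ m)) (m ∸ β) + β * q ^ n ≡⟨ cong (_+ β * q ^ n) (trans (∑-cong (m ∸ β) low) (∑-zero (m ∸ β))) ⟩
    β * q ^ n                                                          ∎
    where
    open ≡-Reasoning
    -- the remaining digits would need a leading index 0, which never occurs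
    low : ∀ d → d < m ∸ β → headTotal n (m * 0 + β + suc d ∸ m) ≡ 0
    low d d< = trans (cong (headTotal n) (m≤n⇒m∸n≡0 index≤m)) (headTotal-zero n)
      where
      index≤m : m * 0 + β + suc d ≤ m
      index≤m = subst (_≤ m) (trans (+-comm (suc d) β) (cong (_+ suc d) (sym (cong (_+ β) (*-zeroʳ m)))))
                      (m≤o∸n⇒m+n≤o (suc d) (<⇒≤ β<m) d<)
  newGaps-value (suc α) β n β<m α<n = begin
    newGaps (m * suc α + β) n                                                ≡⟨ newGaps-split (suc α) β n β<m α<n ⟩
    ∑ (λ d → headTotal n (m * suc α + β + suc d ∸ m)) (m ∸ β) + β * X        ≡⟨ cong (_+ β * X) (trans (∑-cong (m ∸ β) low) (∑-const (q * X) (m ∸ β))) ⟩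
    (m ∸ β) * (q * X) + β * X                                                ≡⟨ solve 4 (λ t b x q → t :* (q :* x) :+ b :* x := (t :* q :+ b) :* x) refl (m ∸ β) β X q ⟩
    K (suc α) β * X                                                          ∎
    where
    open ≡-Reasoning
    X = q ^ (n ∸ suc α)
    n∸α≡ : ∀ a n → a < n → n ∸ a ≡ suc (n ∸ suc a)
    n∸α≡ zero    (suc n) _         = refl
    n∸α≡ (suc a) (suc n) (s≤s a<n) = n∸α≡ a n a<n
    -- the remaining digits d create a gap g after the index mα + β + d + 1 of the previous block
    low : ∀ d → d < m ∸ β → headTotal n (m * suc α + β + suc d ∸ m) ≡ q * X
    low d d< = begin
      headTotal n (m * suc α + β + suc d ∸ m)  ≡⟨ cong (headTotal n) (trans (cong (_∸ m) index≡) (m+n∸m≡n m _)) ⟩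
      headTotal n (m * α + suc (β + d))        ≡⟨ headTotal-formula α n (β + d) β+d<m (≤-trans (n≤1+n α) α<n) ⟩
      q ^ (n ∸ α)                              ≡⟨ cong (q ^_) (n∸α≡ α n α<n) ⟩
      q * X                                    ∎
      where
      index≡ : m * suc α + β + suc d ≡ m + (m * α + suc (β + d))
      index≡ = solve 4 (λ m a b d → m :* (con 1 :+ a) :+ b :+ (con 1 :+ d) := m :+ (m :* a :+ (con 1 :+ (b :+ d)))) refl m α β d
      β+d<m : β + d < m
      β+d<m = subst (_≤ m) (cong suc (+-comm d β)) (m≤o∸n⇒m+n≤o (suc d) (<⇒≤ β<m) d<)

  -- Numerator and denominator of P_{n+1}(g) (see Counting.Pn-exact).
  numerator : ℕ → ℕ → ℕ
  numerator g n = 2 * total n (gapCount g) + headTotal n g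

  denominator : ℕ → ℕ
  denominator n = 2 * total n gapTotal + total n nonEmpty

  denominator-closed : ∀ n → denominator n + q ^ suc n ≡ 2 * (suc n * m * q ^ n) + 1
  denominator-closed n = +-cancelʳ-≡ (q ^ suc n + 1) _ _ (begin
    2 * GT + NE + Q + (Q + 1)        ≡⟨ solve 3 (λ G N Q → con 2 :* G :+ N :+ Q :+ (Q :+ con 1) := con 2 :* (G :+ Q) :+ (N :+ con 1)) refl GT NE Q ⟩
    2 * (GT + Q) + (NE + 1)          ≡⟨ cong₂ (λ u v → 2 * u + v) (total-gapTotal n) (total-nonEmpty n) ⟩
    2 * (suc n * m * q ^ n + 1) + Q  ≡⟨ solve 2 (λ a Q → con 2 :* (a :+ con 1) :+ Q := con 2 :* a :+ con 1 :+ (Q :+ con 1)) refl (suc n * m * q ^ n) Q ⟩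
    2 * (suc n * m * q ^ n) + 1 + (Q + 1) ∎)
    where
    open ≡-Reasoning
    GT = total n gapTotal
    NE = total n nonEmpty
    Q = q ^ suc n

  denominator-lower : ∀ n → 1 ≤ n → suc n * q ^ n ≤ denominator n
  denominator-lower (suc n) _ = +-cancelʳ-≤ (q ^ suc N) _ _ (begin
    suc N * p + q * p                   ≡⟨ *-distribʳ-+ p (suc N) q ⟨
    (suc N + q) * p                     ≤⟨ *-monoˡ-≤ p coefficients ⟩
    2 * (suc N * m) * p                 ≡⟨ solve 3 (λ a b c → con 2 :* (a :* b) :* c := con 2 :* (a :* b :* c)) refl (suc N) m p ⟩
    2 * (suc N * m * p)                 ≤⟨ m≤m+n _ 1 ⟩
    2 * (suc N * m * p) + 1             ≡⟨ denominator-closed N ⟨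
    denominator N + q ^ suc N           ∎)
    where
    open ≤-Reasoning
    N = suc n
    p = q ^ N
    coefficients : suc N + q ≤ 2 * (suc N * m)
    coefficients = subst (λ x → suc N + suc x ≤ 2 * (suc N * x)) (suc-pred m)
      (subst (suc N + suc (suc (pred m)) ≤_)
             (solve 2 (λ a b → (a :+ con 3 :* b :+ con 2 :* a :* b) :+ ((con 2 :+ a) :+ (con 2 :+ b))
                               := con 2 :* ((con 2 :+ a) :* (con 1 :+ b))) refl n (pred m))
             (m≤n+m _ _))

  -- Since the denominator grows like n·qⁿ, an error C·q^{n+1} becomes
  -- negligible once n > C·q·(r+1).
  error-small : ∀ C E p r n → 0 < E → 1 ≤ n → C * q * suc r < suc n → C * q ^ suc n * suc r < suc p * (denominator n * E)
  error-small C E p r n E>0 n≥1 n-large = begin-strict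
    C * q ^ suc n * suc r        ≡⟨ solve 4 (λ c q p r → c :* (q :* p) :* r := c :* q :* r :* p) refl C q (q ^ n) (suc r) ⟩
    C * q * suc r * q ^ n        <⟨ *-monoˡ-< (q ^ n) {{m^n≢0 q n}} n-large ⟩
    suc n * q ^ n                ≤⟨ denominator-lower n n≥1 ⟩
    denominator n                ≤⟨ m≤m*n (denominator n) E {{>-nonZero E>0}} ⟩
    denominator n * E            ≤⟨ m≤n*m (denominator n * E) (suc p) ⟩
    suc p * (denominator n * E)  ∎
    where open ≤-Reasoning

  module Estimate (α β : ℕ) (β<m : β < m) where

    g : ℕ
    g = m * α + β

    -- P(g) = K α β / limDen.
    limDen : ℕ
    limDen = m * q ^ suc α

    Gs GT NE : ℕ → ℕ
    Gs n = total n (gapCount g)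
    GT n = total n gapTotal
    NE n = total n nonEmpty

    Zp Zn : ℕ
    Zp = limDen * Gs α + K α β
    Zn = K α β * GT α

    limDen-power : ∀ t → limDen * q ^ t ≡ m * q ^ suc (α + t)
    limDen-power t = trans (*-assoc m (q ^ suc α) (q ^ t)) (cong (m *_) (sym (^-distribˡ-+-* q (suc α) t)))

    -- The exact invariant: limDen·Gs n - K·GT n + K is multiplied by q at each
    -- step from n = α on (written without subtraction).
    invariant : ∀ t → limDen * Gs (α + t) + K α β + q ^ t * Zn ≡ K α β * GT (α + t) + q ^ t * Zp
    invariant zero rewrite +-identityʳ α =
      solve 4 (λ e G k T → e :* G :+ k :+ con 1 :* (k :* T) := k :* T :+ con 1 :* (e :* G :+ k)) refl limDen (Gs α) (K α β) (GT α)
    invariant (suc t) = +-cancelʳ-≡ (q * Kv) _ _ (begin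
      limDen * Gs (α + suc t) + Kv + q ^ suc t * Zn + q * Kv
        ≡⟨ cong (λ z → limDen * z + Kv + q ^ suc t * Zn + q * Kv) (trans (cong Gs (+-suc α t)) (gapCount-suc g n)) ⟩
      limDen * (q * G + newGaps g n) + Kv + q * P * Zn + q * Kv
        ≡⟨ cong (λ z → limDen * (q * G + z) + Kv + q * P * Zn + q * Kv)
                (trans (newGaps-value α β n β<m (m≤m+n α t)) (cong (λ z → Kv * q ^ z) (m+n∸m≡n α t))) ⟩
      limDen * (q * G + Kv * P) + Kv + q * P * Zn + q * Kv
        ≡⟨ solve 7 (λ e G k P z m T → e :* ((con 1 :+ m) :* G :+ k :* P) :+ k :+ (con 1 :+ m) :* P :* z :+ (con 1 :+ m) :* k
                 := (con 1 :+ m) :* (e :* G :+ k :+ P :* z) :+ k :* (e :* P) :+ k) refl limDen G Kv P Zn m T ⟩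
      q * (limDen * G + Kv + P * Zn) + Kv * (limDen * P) + Kv
        ≡⟨ cong₂ (λ u v → q * u + Kv * v + Kv) (invariant t) (limDen-power t) ⟩
      q * (Kv * T + P * Zp) + Kv * (m * q ^ suc n) + Kv
        ≡⟨ cong (λ z → q * (Kv * T + P * Zp) + Kv * (m * z) + Kv) (total-nonEmpty n) ⟨
      q * (Kv * T + P * Zp) + Kv * (m * (NE n + 1)) + Kv
        ≡⟨ solve 6 (λ k T P z m N → (con 1 :+ m) :* (k :* T :+ P :* z) :+ k :* (m :* (N :+ con 1)) :+ k
                 := k :* ((con 1 :+ m) :* T :+ m :* N) :+ (con 1 :+ m) :* P :* z :+ (con 1 :+ m) :* k) refl Kv T P Zp m (NE n) ⟩
      Kv * (q * T + m * NE n) + q * P * Zp + q * Kv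
        ≡⟨ cong (λ z → Kv * z + q * P * Zp + q * Kv) (trans (cong GT (+-suc α t)) (total-gapTotal-suc n)) ⟨
      Kv * GT (α + suc t) + q ^ suc t * Zp + q * Kv ∎)
      where
      open ≡-Reasoning
      Kv = K α β
      n = α + t
      G = Gs n
      T = GT n
      P = q ^ t

    C : ℕ
    C = 2 * Zp + limDen + 2 * K α β + 2 * Zn + K α β

    balance : ∀ t → limDen * numerator g (α + t) + (2 * K α β + 2 * (q ^ t * Zn) + K α β * NE (α + t))
                  ≡ K α β * denominator (α + t) + (2 * (q ^ t * Zp) + limDen * headTotal (α + t) g)
    balance t = begin
      limDen * (2 * G + H) + (2 * Kv + 2 * (P * Zn) + Kv * N)
        ≡⟨ solve 7 (λ e G H k P z N → e :* (con 2 :* G :+ H) :+ (con 2 :* k :+ con 2 :* (P :* z) :+ k :* N)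
                 := con 2 :* (e :* G :+ k :+ P :* z) :+ e :* H :+ k :* N) refl limDen G H Kv P Zn N ⟩
      2 * (limDen * G + Kv + P * Zn) + limDen * H + Kv * N ≡⟨ cong (λ z → 2 * z + limDen * H + Kv * N) (invariant t) ⟩
      2 * (Kv * T + P * Zp) + limDen * H + Kv * N
        ≡⟨ solve 7 (λ k T P z e H N → con 2 :* (k :* T :+ P :* z) :+ e :* H :+ k :* N
                 := k :* (con 2 :* T :+ N) :+ (con 2 :* (P :* z) :+ e :* H)) refl Kv T P Zp limDen H N ⟩
      Kv * (2 * T + N) + (2 * (P * Zp) + limDen * H) ∎
      where
      open ≡-Reasoning
      Kv = K α β
      G = Gs (α + t)
      H = headTotal (α + t) g
      T = GT (α + t)
      N = NE (α + t)
      P = q ^ t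

    q^t≤ : ∀ t → q ^ t ≤ q ^ suc (α + t)
    q^t≤ t = ^-monoʳ-≤ q (≤-trans (m≤n+m t α) (n≤1+n _))

    error₁ : ∀ t → 2 * (q ^ t * Zp) + limDen * headTotal (α + t) g ≤ C * q ^ suc (α + t)
    error₁ t = begin
      2 * (q ^ t * Zp) + limDen * headTotal (α + t) g
        ≤⟨ +-mono-≤ (*-monoʳ-≤ 2 (*-monoˡ-≤ Zp (q^t≤ t)))
                    (*-monoʳ-≤ limDen (total-bounded (α + t) (headIs g) (headIs≤1 g))) ⟩
      2 * (Q * Zp) + limDen * Q   ≡⟨ solve 3 (λ Q z e → con 2 :* (Q :* z) :+ e :* Q := (con 2 :* z :+ e) :* Q) refl Q Zp limDen ⟩
      (2 * Zp + limDen) * Q       ≤⟨ *-monoˡ-≤ Q (≤-trans (m≤m+n (2 * Zp + limDen) (2 * K α β)) (≤-trans (m≤m+n _ (2 * Zn)) (m≤m+n _ (K α β)))) ⟩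
      C * Q                       ∎
      where
      open ≤-Reasoning
      Q = q ^ suc (α + t)

    error₂ : ∀ t → 2 * K α β + 2 * (q ^ t * Zn) + K α β * NE (α + t) ≤ C * q ^ suc (α + t)
    error₂ t = begin
      2 * Kv + 2 * (q ^ t * Zn) + Kv * NE (α + t)
        ≤⟨ +-mono-≤ (+-mono-≤ (*-monoʳ-≤ 2 (subst (_≤ Kv * Q) (*-identityʳ Kv) (*-monoʳ-≤ Kv (m^n>0 q (suc (α + t))))))
                              (*-monoʳ-≤ 2 (*-monoˡ-≤ Zn (q^t≤ t))))
                    (*-monoʳ-≤ Kv (total-bounded (α + t) nonEmpty nonEmpty≤1)) ⟩
      2 * (Kv * Q) + 2 * (Q * Zn) + Kv * Q ≡⟨ solve 3 (λ Q z k → con 2 :* (k :* Q) :+ con 2 :* (Q :* z) :+ k :* Q := (con 2 :* k :+ con 2 :* z :+ k) :* Q) refl Q Zn Kv ⟩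
      (2 * Kv + 2 * Zn + Kv) * Q           ≤⟨ *-monoˡ-≤ Q (subst (2 * Kv + 2 * Zn + Kv ≤_)
                                                 (solve 4 (λ a b c d → a :+ (b :+ c :+ d) := a :+ b :+ c :+ d) refl (2 * Zp + limDen) (2 * Kv) (2 * Zn) Kv)
                                                 (m≤n+m _ (2 * Zp + limDen))) ⟩
      C * Q                                ∎
      where
      open ≤-Reasoning
      Kv = K α β
      Q = q ^ suc (α + t)

    estimate : ∀ t → let n = α + t in
      numerator g n * limDen ≤ K α β * denominator n + C * q ^ suc n ×
      K α β * denominator n ≤ numerator g n * limDen + C * q ^ suc n
    estimate t = subst (_≤ Kv * Den + X) (*-comm limDen Num) upper ,
                 subst (λ x → Kv * Den ≤ x + X) (*-comm limDen Num) lower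
      where
      Kv = K α β
      Num = numerator g (α + t)
      Den = denominator (α + t)
      X = C * q ^ suc (α + t)
      upper : limDen * Num ≤ Kv * Den + X
      upper = ≤-trans (m≤m+n (limDen * Num) _) (≤-trans (≤-reflexive (balance t)) (+-monoʳ-≤ (Kv * Den) (error₁ t)))
      lower : Kv * Den ≤ limDen * Num + X
      lower = ≤-trans (m≤m+n (Kv * Den) _) (≤-trans (≤-reflexive (sym (balance t))) (+-monoʳ-≤ (limDen * Num) (error₂ t)))

  ∑-twice : ∀ f h n → ∑ (λ j → f j + (h j + f j)) n ≡ 2 * ∑ f n + ∑ h n
  ∑-twice f h n = begin
    ∑ (λ j → f j + (h j + f j)) n  ≡⟨ ∑-cong n (λ j _ → solve 2 (λ f h → f :+ (h :+ f) := con 2 :* f :+ h) refl (f j) (h j)) ⟩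
    ∑ (λ j → 2 * f j + h j) n      ≡⟨ ∑-+ (λ j → 2 * f j) h n ⟩
    ∑ (λ j → 2 * f j) n + ∑ h n    ≡⟨ cong (_+ ∑ h n) (∑-*ˡ 2 f n) ⟩
    2 * ∑ f n + ∑ h n              ∎
    where open ≡-Reasoning

  headGap-zero : ∀ g L → headGap g 0 L ≡ headIs g L
  headGap-zero g []      = refl
  headGap-zero g (y ∷ L) = refl

  module Counting (a : ℕ → ℕ) (isM : IsMGonal m a)
                  (dec : ℕ → List ℕ) (decOK : (z : ℕ) → LegalDec m a (dec z) z) where

    open Decompositions a isM dec decOK

    -- Summing over z < a_{m(n+1)+1} = 2q^{n+1} is summing over the
    -- decompositions rep n j and 0 ∷ rep n j, j < q^{n+1}.
    sum-decompositions : ∀ n (F : List ℕ → ℕ) →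
      sum (map (λ z → F (dec z)) (upTo (a (m * suc n + 1)))) ≡ total n (λ L → F L + F (0 ∷ L))
    sum-decompositions n F = begin
      sum (map (F ∘ dec) (upTo (a (m * suc n + 1))))       ≡⟨ sum-upTo (F ∘ dec) (a (m * suc n + 1)) ⟩
      ∑ (F ∘ dec) (a (m * suc n + 1))                      ≡⟨ cong (∑ (F ∘ dec)) (a-top n) ⟩
      ∑ (F ∘ dec) (q ^ suc n * 2)                          ≡⟨ ∑-blocks (F ∘ dec) (q ^ suc n) 2 ⟩
      ∑ (λ j → F (dec (0 + j * 2)) + (F (dec (1 + j * 2)) + 0)) (q ^ suc n)
                                                           ≡⟨ ∑-cong (q ^ suc n) (λ j j< → cong₂ _+_ (cong F (dec-rep n 0 j (s≤s z≤n) j<))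
                                                                (trans (+-identityʳ _) (cong F (dec-rep n 1 j (s≤s (s≤s z≤n)) j<)))) ⟩
      total n (λ L → F L + F (0 ∷ L))                      ∎
      where open ≡-Reasoning

    Pn-exact : ∀ n g → Pn m a dec (suc n) g ≡ frac (numerator g n) (denominator n)
    Pn-exact n g = cong₂ frac
      (trans (sum-decompositions n (gapCount g))
             (trans (∑-cong (q ^ suc n) (λ j _ → cong (gapCount g (rep n j) +_)
                                                     (trans (gapCount-∷ g 0 (rep n j)) (cong (_+ gapCount g (rep n j)) (headGap-zero g (rep n j))))))
                    (∑-twice (gapCount g ∘ rep n) (headIs g ∘ rep n) (q ^ suc n))))
      (trans (sum-decompositions n gapTotal)
             (trans (∑-cong (q ^ suc n) (λ j _ → cong (gapTotal (rep n j) +_) (gapTotal-∷ 0 (rep n j))))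
                    (∑-twice (gapTotal ∘ rep n) (nonEmpty ∘ rep n) (q ^ suc n))))

    converges : ∀ α β → β < m → ∀ p r .(cop : Coprime (suc p) (suc r)) → Σ ℕ λ N → ∀ n → N ≤ n → 1 ≤ n →
      ℚ.∣ Pn m a dec n (m * α + β) ℚ.- frac (K α β) (m * q ^ suc α) ∣ ℚ.< mkℚ (ℤ.+ suc p) r cop
    converges α β β<m p r cop = suc (suc (C * q * suc r + α)) , close
      where
      open Estimate α β β<m
      close : ∀ n → suc (suc (C * q * suc r + α)) ≤ n → 1 ≤ n →
        ℚ.∣ Pn m a dec n g ℚ.- frac (K α β) limDen ∣ ℚ.< mkℚ (ℤ.+ suc p) r cop
      close (suc n) (s≤s n-large) _ rewrite Pn-exact n g =
        frac-close (numerator g n) (denominator n) (K α β) limDen p r cop (C * q ^ suc n)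
                   (<-≤-trans (m^n>0 q n) (≤-trans (m≤m*n (q ^ n) (suc n)) (≤-trans (≤-reflexive (*-comm (q ^ n) (suc n))) (denominator-lower n n≥1))))
                   limDen-positive (proj₁ bounds) (proj₂ bounds)
                   (error-small C limDen p r n limDen-positive n≥1 (m<n⇒m<1+n (≤-trans (s≤s (m≤m+n _ α)) n-large)))
        where
        n≥1 : 1 ≤ n
        n≥1 = ≤-trans (s≤s z≤n) n-large
        α≤n : α ≤ n
        α≤n = ≤-trans (m≤n+m α _) (≤-trans (n≤1+n _) n-large)
        limDen-positive : 0 < limDen
        limDen-positive = ≤-trans (m^n>0 q (suc α)) (m≤n*m (q ^ suc α) m)
        bounds : numerator g n * limDen ≤ K α β * denominator n + C * q ^ suc n ×
                 K α β * denominator n ≤ numerator g n * limDen + C * q ^ suc n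
        bounds = subst (λ k → numerator g k * limDen ≤ K α β * denominator k + C * q ^ suc k ×
                              K α β * denominator k ≤ numerator g k * limDen + C * q ^ suc k)
                       (m+[n∸m]≡n α≤n) (estimate (n ∸ α))

  Plim≡frac : ∀ g → Plim m g ≡ frac (K (g / m) (g % m)) (m * q ^ suc (g / m))
  Plim≡frac g with g / m | g % m | m%n<n g m
  ... | zero  | β | _   = trans (/-as-frac β (m * suc m) {{m*n≢0 m (suc m)}}) (cong (frac β) (cong (m *_) (sym (*-identityʳ q))))
  ... | suc α | β | β<m =
    trans (/-as-frac (q ∸ β) Q {{m^n≢0 q (suc (suc α))}})
          (frac-cross (q ∸ β) Q (K (suc α) β) (m * Q) (m^n>0 q (suc (suc α))) (≤-trans (m^n>0 q (suc (suc α))) (m≤n*m Q m)) cross)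
    where
    Q = q ^ suc (suc α)
    t = m ∸ β
    cross : (q ∸ β) * (m * Q) ≡ (t * q + β) * Q
    cross = begin
      (q ∸ β) * (m * Q)           ≡⟨ cong (_* (m * Q)) (+-∸-assoc 1 (<⇒≤ β<m)) ⟩
      suc t * (m * Q)             ≡⟨ subst (λ x → suc t * (x * Q) ≡ (t * suc x + β) * Q) (m∸n+n≡m (<⇒≤ β<m))
                                          (solve 3 (λ t b Q → (con 1 :+ t) :* ((t :+ b) :* Q) := (t :* (con 1 :+ (t :+ b)) :+ b) :* Q) refl t β Q) ⟩
      (t * q + β) * Q             ∎
      where open ≡-Reasoning

theorem1p7 : (m : ℕ) → .{{_ : NonZero m}} → (a : ℕ → ℕ) → IsMGonal m a
    → (dec : ℕ → List ℕ) → ((z : ℕ) → LegalDec m a (dec z) z)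
    → (g : ℕ) → 1 ≤ g
    → (ε : ℚ) → ℚ.0ℚ ℚ.< ε
    → Σ ℕ λ N → (n : ℕ) → N ≤ n → 1 ≤ n → ℚ.∣ Pn m a dec n g ℚ.- Plim m g ∣ ℚ.< ε
theorem1p7 m a isM dec decOK g _ ε@(mkℚ (ℤ.+ suc p) r cop) _ =
  proj₁ approximation , λ n N≤n n≥1 →
    subst₂ (λ h l → ℚ.∣ Pn m a dec n h ℚ.- l ∣ ℚ.< ε) (sym (index-split g)) (sym (Plim≡frac g)) (proj₂ approximation n N≤n n≥1)
  where
  open Gonal m
  open Counting a isM dec decOK
  approximation : Σ ℕ λ N → ∀ n → N ≤ n → 1 ≤ n →
    ℚ.∣ Pn m a dec n (m * (g / m) + g % m) ℚ.- frac (K (g / m) (g % m)) (m * q ^ suc (g / m)) ∣ ℚ.< ε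
  approximation = converges (g / m) (g % m) (m%n<n g m) p r cop
-- a positive ε has a positive numerator
theorem1p7 m a isM dec decOK g _ (mkℚ (ℤ.+ zero) r cop) (ℚ.*<* (ℤ.+<+ ()))
theorem1p7 m a isM dec decOK g _ (mkℚ ℤ.-[1+ k ] r cop) (ℚ.*<* ())
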